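{- Let $d>0$ be a squarefree integer. There exists a constant $C_d\ge 1$, depending only on $d$, such that for all $\alpha,\beta\in\mathcal{O}_d\setminus\{0\}$ with $\langle\alpha,\beta\rangle=\mathcal{O}_d$ there exist $x,y\in\mathcal{O}_d$ with $$1=\alpha x+\beta y,\qquad |x|\le C_d|\beta|,\qquad |y|\le C_d|\alpha|.$$
   Context: $\mathcal{O}_d$ is the ring of integers of $\mathbb{Q}(\sqrt{ -d})$, i.e. $\mathcal{O}_d=\mathbb{Z}[\omega]$ with $\omega=\frac{ -1+\sqrt{ -d}}{2}$ if $d\equiv 3\pmod 4$ and $\omega=\sqrt{ -d}$ otherwise; $|\cdot|$ is the complex absolute value; $\langle\alpha,\beta\rangle$ is the ideal generated by $\alpha,\beta$. -}

module Defs where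

open import Data.Nat as ℕ using (ℕ; NonZero; _%_)
open import Data.Nat.Divisibility using (_∣_)
open import Data.Nat.DivMod using (_/_)
open import Data.Integer using (ℤ; +_; _+_; _*_; -_; _-_; 0ℤ; 1ℤ)
open import Data.Bool using (Bool; if_then_else_)
open import Relation.Nullary using (does)
open import Relation.Binary.PropositionalEquality using (_≡_)
open import Data.Product using (∃-syntax)

Squarefree : ℕ → Set
Squarefree d = ∀ (p : ℕ) → p ℕ.* p ∣ d → p ≡ 1

isThreeMod4 : ℕ → Bool
isThreeMod4 d = does (d % 4 ℕ.≟ 3)

record 𝒪 (d : ℕ) : Set where
  constructor _+_ω
  field
    re : ℤ
    im : ℤ
open 𝒪 public

-- ω² = sqP d + sqQ d · ω
--   d ≡ 3 (mod 4):  ω = (-1+√-d)/2,  ω² = -(1+d)/4 - ω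
--   otherwise:      ω = √-d,        ω² = -d
sqP : ℕ → ℤ
sqP d = if isThreeMod4 d then - (+ ((1 ℕ.+ d) / 4)) else - (+ d)

sqQ : ℕ → ℤ
sqQ d = if isThreeMod4 d then - 1ℤ else 0ℤ

zero𝒪 : ∀ {d} → 𝒪 d
zero𝒪 = 0ℤ + 0ℤ ω

one𝒪 : ∀ {d} → 𝒪 d
one𝒪 = 1ℤ + 0ℤ ω

_⊕_ : ∀ {d} → 𝒪 d → 𝒪 d → 𝒪 d
(a + b ω) ⊕ (c + e ω) = (a + c) + (b + e) ω

-- (a + bω)(c + eω) = ac + be·ω² + (ae + bc)ω
_⊗_ : ∀ {d} → 𝒪 d → 𝒪 d → 𝒪 d
_⊗_ {d} (a + b ω) (c + e ω) =
  (a * c + b * e * sqP d) + (a * e + b * c + b * e * sqQ d) ω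

absSq : ∀ {d} → 𝒪 d → ℤ
absSq {d} (a + b ω) =
  if isThreeMod4 d
  then a * a - a * b + (+ ((1 ℕ.+ d) / 4)) * b * b
  else a * a + (+ d) * b * b

GeneratesUnitIdeal : ∀ {d} → 𝒪 d → 𝒪 d → Set
GeneratesUnitIdeal {d} α β = ∃[ u ] ∃[ v ] ((α ⊗ u) ⊕ (β ⊗ v) ≡ one𝒪)

{-# OPTIONS --safe #-}
-- Write |a + bω|² as the binary quadratic form N(a, b) = a² + Qab - Pb², where ω² = P + Qω.
-- It is multiplicative, and for d > 0 its discriminant Q² + 4P is negative, so it is positive
-- definite. Start from any Bézout relation αu + βv = 1 and divide uβ̄ coordinatewise by the
-- positive integer N(β): this gives q such that (u - qβ)β̄ has coordinates in [0, N(β)), whence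
-- N(u - qβ) ≤ (2 + d) N(β). The pair x = u - qβ, y = v + qα still satisfies αx + βy = 1, and
-- N(y) N(β) = N(1 - αx) ≤ 2 + 2 N(α) N(x) (parallelogram law) then bounds N(y) by a multiple
-- of N(α).
module Submission where

open import Defs
open import Data.Nat using (ℕ; _<_; _≤_)
open import Data.Integer using (+_; _*_) renaming (_≤_ to _≤ℤ_)
open import Data.Product using (Σ; _×_; ∃-syntax)
open import Relation.Binary.PropositionalEquality using (_≡_)
open import Relation.Nullary using (¬_)

import Data.Nat as ℕ
import Data.Nat.Properties as ℕ
open import Data.Nat using (NonZero; s≤s; z≤n; ≢-nonZero; >-nonZero⁻¹)
open import Data.Nat.DivMod using (m/n≤m; m≥n⇒m/n>0; m%n≤m)
import Data.Nat.Tactic.RingSolver as ℕ-Solver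
open import Data.Integer using (ℤ; +[1+_]; -[1+_]; _+_; -_; _-_; 0ℤ; 1ℤ; ∣_∣; +≤+; -≤+; -<+)
  renaming (_<_ to _<ℤ_)
import Data.Integer.Properties as ℤ
open import Data.Integer.DivMod using (_/ℕ_; _%ℕ_; a≡a%ℕn+[a/ℕn]*n; n%ℕd<d)
open import Data.Integer.Solver using (module +-*-Solver)
open import Data.Integer.Tactic.RingSolver using (solve-∀)
open import Data.Bool using (if_then_else_; true; false)
open import Data.Product using (_,_; proj₁; proj₂)
open import Data.Empty using (⊥-elim)
open import Data.Sum using (_⊎_; inj₁; inj₂; [_,_]′; reduce)
open import Relation.Nullary using (yes; no; does)
open import Relation.Binary.PropositionalEquality
  using (refl; sym; trans; cong; cong₂; subst; subst₂; module ≡-Reasoning)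

open +-*-Solver using (Polynomial; solve; _:=_; _:+_; _:*_; _:-_; :-_; con)

-- With ω² = P + Qω we have ω + ω̄ = Q and ω ω̄ = -P, so |a + bω|² = a² + Qab - Pb².
norm : ℤ → ℤ → ℤ → ℤ → ℤ
norm P Q a b = a * a + Q * a * b - P * b * b

discriminant : ℤ → ℤ → ℤ
discriminant P Q = Q * Q + + 4 * P

-- norm in the syntax of the non-reflective solver: the reflective one treats norm as an opaque constant
private
  normₚ : ∀ {n} → Polynomial n → Polynomial n → Polynomial n → Polynomial n → Polynomial n
  normₚ P Q a b = a :* a :+ Q :* a :* b :- P :* b :* b

norm-* : ∀ P Q a b c e →
  norm P Q (a * c + b * e * P) (a * e + b * c + b * e * Q) ≡ norm P Q a b * norm P Q c e
norm-* = solve 6 (λ P Q a b c e →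
  normₚ P Q (a :* c :+ b :* e :* P) (a :* e :+ b :* c :+ b :* e :* Q)
    := normₚ P Q a b :* normₚ P Q c e) refl

norm-conj : ∀ P Q a b → norm P Q (a + b * Q) (- b) ≡ norm P Q a b
norm-conj = solve 4 (λ P Q a b → normₚ P Q (a :+ b :* Q) (:- b) := normₚ P Q a b) refl

norm-one : ∀ P Q → norm P Q 1ℤ 0ℤ ≡ 1ℤ
norm-one = solve 2 (λ P Q → normₚ P Q (con 1ℤ) (con 0ℤ) := con 1ℤ) refl

norm-parallelogram : ∀ P Q a b c e →
  norm P Q (a - c) (b - e) + norm P Q (a + c) (b + e) ≡ + 2 * norm P Q a b + + 2 * norm P Q c e
norm-parallelogram = solve 6 (λ P Q a b c e →
  normₚ P Q (a :- c) (b :- e) :+ normₚ P Q (a :+ c) (b :+ e)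
    := con (+ 2) :* normₚ P Q a b :+ con (+ 2) :* normₚ P Q c e) refl

norm-completeSquare : ∀ P Q a b →
  + 4 * norm P Q a b ≡ (+ 2 * a + Q * b) * (+ 2 * a + Q * b) + (- discriminant P Q) * (b * b)
norm-completeSquare = solve 4 (λ P Q a b →
  con (+ 4) :* normₚ P Q a b
    := (con (+ 2) :* a :+ Q :* b) :* (con (+ 2) :* a :+ Q :* b)
         :+ (:- (Q :* Q :+ con (+ 4) :* P)) :* (b :* b)) refl

norm-real : ∀ P Q a → norm P Q a 0ℤ ≡ a * a
norm-real = solve 3 (λ P Q a → normₚ P Q a (con 0ℤ) := a :* a) refl

norm-split : ∀ k Q a b → norm (- k) Q a b ≡ (a * a + k * (b * b)) + Q * (a * b)
norm-split = solve 4 (λ k Q a b →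
  normₚ (:- k) Q a b := (a :* a :+ k :* (b :* b)) :+ Q :* (a :* b)) refl

square-nonneg : ∀ x → 0ℤ ≤ℤ x * x
square-nonneg (+ ℕ.zero) = +≤+ z≤n
square-nonneg +[1+ n ] = +≤+ z≤n
square-nonneg -[1+ n ] = +≤+ z≤n

*-nonneg : ∀ {i j} → 0ℤ ≤ℤ i → 0ℤ ≤ℤ j → 0ℤ ≤ℤ i * j
*-nonneg {+ m} {+ n} _ _ = subst (0ℤ ≤ℤ_) (ℤ.pos-* m n) (+≤+ z≤n)

square≡0⇒≡0 : ∀ x → x * x ≡ 0ℤ → x ≡ 0ℤ
square≡0⇒≡0 x x²≡0 = reduce (ℤ.i*j≡0⇒i≡0∨j≡0 x x²≡0)

nonneg-+≡0 : ∀ {i j} → 0ℤ ≤ℤ i → 0ℤ ≤ℤ j → i + j ≡ 0ℤ → i ≡ 0ℤ × j ≡ 0ℤ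
nonneg-+≡0 {+ ℕ.zero} {+ ℕ.zero} _ _ _ = refl , refl

module _ {D : ℤ} (0<D : 0ℤ <ℤ D) where

  private
    0≤D : 0ℤ ≤ℤ D
    0≤D = ℤ.<⇒≤ 0<D

  squares-nonneg : ∀ x y → 0ℤ ≤ℤ x * x + D * (y * y)
  squares-nonneg x y = ℤ.+-mono-≤ (square-nonneg x) (*-nonneg 0≤D (square-nonneg y))

  squares≡0⇒≡0 : ∀ x y → x * x + D * (y * y) ≡ 0ℤ → x ≡ 0ℤ × y ≡ 0ℤ
  squares≡0⇒≡0 x y sum≡0 with nonneg-+≡0 (square-nonneg x) (*-nonneg 0≤D (square-nonneg y)) sum≡0
  ... | x²≡0 , Dy²≡0 = square≡0⇒≡0 x x²≡0 , [ D≢0 , square≡0⇒≡0 y ]′ (ℤ.i*j≡0⇒i≡0∨j≡0 D Dy²≡0)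
    where
    D≢0 : D ≡ 0ℤ → y ≡ 0ℤ
    D≢0 refl = ⊥-elim (ℤ.<-irrefl refl 0<D)

module _ {P Q : ℤ} (Δ<0 : discriminant P Q <ℤ 0ℤ) where

  private
    0<-Δ : 0ℤ <ℤ - discriminant P Q
    0<-Δ = ℤ.neg-mono-< Δ<0

  norm-nonneg : ∀ a b → 0ℤ ≤ℤ norm P Q a b
  norm-nonneg a b = ℤ.*-cancelˡ-≤-pos 0ℤ (norm P Q a b) (+ 4)
    (subst (0ℤ ≤ℤ_) (sym (norm-completeSquare P Q a b)) (squares-nonneg 0<-Δ (+ 2 * a + Q * b) b))

  norm≡0⇒≡0 : ∀ a b → norm P Q a b ≡ 0ℤ → a ≡ 0ℤ × b ≡ 0ℤ
  norm≡0⇒≡0 a b N≡0 = a≡0 , b≡0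
    where
    b≡0 : b ≡ 0ℤ
    b≡0 = proj₂ (squares≡0⇒≡0 0<-Δ (+ 2 * a + Q * b) b
      (trans (sym (norm-completeSquare P Q a b)) (cong (+ 4 *_) N≡0)))
    a≡0 : a ≡ 0ℤ
    a≡0 = square≡0⇒≡0 a (trans (sym (norm-real P Q a)) (subst (λ b → norm P Q a b ≡ 0ℤ) b≡0 N≡0))

norm-≤ : ∀ {k Q} → Q ≤ℤ 0ℤ → ∀ {a b M} → a ≤ M → b ≤ M →
  norm (- + k) Q (+ a) (+ b) ≤ℤ + ((1 ℕ.+ k) ℕ.* (M ℕ.* M))
norm-≤ {k} {Q} Q≤0 {a} {b} {M} a≤M b≤M = begin
  norm (- + k) Q (+ a) (+ b)              ≡⟨ norm-split (+ k) Q (+ a) (+ b) ⟩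
  (+ a * + a + + k * (+ b * + b)) + Q * (+ a * + b)
    ≤⟨ ℤ.+-monoʳ-≤ (+ a * + a + + k * (+ b * + b)) Q·ab≤0 ⟩
  (+ a * + a + + k * (+ b * + b)) + 0ℤ    ≡⟨ ℤ.+-identityʳ _ ⟩
  + a * + a + + k * (+ b * + b)           ≡⟨ cong₂ _+_ (sym (ℤ.pos-* a a)) k·b²≡ ⟩
  + (a ℕ.* a ℕ.+ k ℕ.* (b ℕ.* b))        ≤⟨ +≤+ (ℕ.+-mono-≤ (ℕ.*-mono-≤ a≤M a≤M)
                                              (ℕ.*-monoʳ-≤ k (ℕ.*-mono-≤ b≤M b≤M))) ⟩
  + ((1 ℕ.+ k) ℕ.* (M ℕ.* M))             ∎
  where
  open ℤ.≤-Reasoning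
  Q·ab≤0 : Q * (+ a * + b) ≤ℤ 0ℤ
  Q·ab≤0 = subst (λ n → Q * n ≤ℤ 0ℤ) (ℤ.pos-* a b) (ℤ.*-monoʳ-≤-nonNeg (+ (a ℕ.* b)) Q≤0)
  k·b²≡ : + k * (+ b * + b) ≡ + (k ℕ.* (b ℕ.* b))
  k·b²≡ = trans (cong (+ k *_) (sym (ℤ.pos-* b b))) (sym (ℤ.pos-* k (b ℕ.* b)))

ω²-cases : ∀ d →
  (d ℕ.% 4 ≡ 3 × sqP d ≡ - + ((1 ℕ.+ d) ℕ./ 4) × sqQ d ≡ - 1ℤ) ⊎ (sqP d ≡ - + d × sqQ d ≡ 0ℤ)
ω²-cases d with d ℕ.% 4 ℕ.≟ 3 in eq
... | yes d%4≡3 = inj₁ (d%4≡3 , cong (λ h → if does h then - + ((1 ℕ.+ d) ℕ./ 4) else - + d) eq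
                              , cong (λ h → if does h then - 1ℤ else 0ℤ) eq)
... | no _      = inj₂ (cong (λ h → if does h then - + ((1 ℕ.+ d) ℕ./ 4) else - + d) eq
                       , cong (λ h → if does h then - 1ℤ else 0ℤ) eq)

sqQ≤0 : ∀ d → sqQ d ≤ℤ 0ℤ
sqQ≤0 d with ω²-cases d
... | inj₁ (_ , _ , Q≡) = subst (_≤ℤ 0ℤ) (sym Q≡) -≤+
... | inj₂ (_ , Q≡)     = subst (_≤ℤ 0ℤ) (sym Q≡) ℤ.≤-refl

sqP≡-k : ∀ d → ∃[ k ] (k ≤ 1 ℕ.+ d × sqP d ≡ - + k)
sqP≡-k d with ω²-cases d
... | inj₁ (_ , P≡ , _) = _ , m/n≤m (1 ℕ.+ d) 4 , P≡
... | inj₂ (P≡ , _)     = d , ℕ.n≤1+n d , P≡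

discriminant<0 : ∀ {d} → 0 < d → discriminant (sqP d) (sqQ d) <ℤ 0ℤ
discriminant<0 {d} 0<d with ω²-cases d
... | inj₁ (d%4≡3 , P≡ , Q≡) rewrite P≡ | Q≡ =
  ℤ.≤-<-trans (ℤ.+-monoʳ-≤ 1ℤ (ℤ.*-monoˡ-≤-nonNeg (+ 4) (ℤ.neg-mono-≤ (+≤+ 1≤k)))) -<+
  where
  1≤k : 1 ≤ (1 ℕ.+ d) ℕ./ 4
  1≤k = m≥n⇒m/n>0 (s≤s (subst (_≤ d) d%4≡3 (m%n≤m d 4)))
... | inj₂ (P≡ , Q≡) rewrite P≡ | Q≡ with d
...   | ℕ.suc _ = -<+

absSq≡norm : ∀ {d} (z : 𝒪 d) → absSq z ≡ norm (sqP d) (sqQ d) (re z) (im z)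
absSq≡norm {d} (a + b ω) = by-cases (isThreeMod4 d)
  where
  k = (1 ℕ.+ d) ℕ./ 4
  by-cases : ∀ t →
    (if t then a * a - a * b + + k * b * b else a * a + + d * b * b)
      ≡ norm (if t then - + k else - + d) (if t then - 1ℤ else 0ℤ) a b
  by-cases true  = solve 3 (λ k a b → a :* a :- a :* b :+ k :* b :* b
                                        := normₚ (:- k) (:- con 1ℤ) a b) refl (+ k) a b
  by-cases false = solve 3 (λ d a b → a :* a :+ d :* b :* b
                                        := normₚ (:- d) (con 0ℤ) a b) refl (+ d) a b

embed : ∀ {d} → ℤ → 𝒪 d
embed n = n + 0ℤ ω

_⊖_ : ∀ {d} → 𝒪 d → 𝒪 d → 𝒪 d
(a + b ω) ⊖ (c + e ω) = (a - c) + (b - e) ω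

-- ω̄ = sqQ d - ω
conj : ∀ {d} → 𝒪 d → 𝒪 d
conj {d} (a + b ω) = (a + b * sqQ d) + (- b) ω

absSq-⊗ : ∀ {d} (z w : 𝒪 d) → absSq (z ⊗ w) ≡ absSq z * absSq w
absSq-⊗ {d} z@(a + b ω) w@(c + e ω) = begin
  absSq (z ⊗ w)                       ≡⟨ absSq≡norm (z ⊗ w) ⟩
  norm (sqP d) (sqQ d) (re (z ⊗ w)) (im (z ⊗ w)) ≡⟨ norm-* (sqP d) (sqQ d) a b c e ⟩
  norm (sqP d) (sqQ d) a b * norm (sqP d) (sqQ d) c e
                                      ≡⟨ sym (cong₂ _*_ (absSq≡norm z) (absSq≡norm w)) ⟩
  absSq z * absSq w                   ∎
  where open ≡-Reasoning

absSq-conj : ∀ {d} (z : 𝒪 d) → absSq (conj z) ≡ absSq z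
absSq-conj {d} z@(a + b ω) =
  trans (absSq≡norm (conj z)) (trans (norm-conj (sqP d) (sqQ d) a b) (sym (absSq≡norm z)))

absSq-one : ∀ {d} → absSq {d} one𝒪 ≡ 1ℤ
absSq-one {d} = trans (absSq≡norm {d} one𝒪) (norm-one (sqP d) (sqQ d))

absSq-parallelogram : ∀ {d} (z w : 𝒪 d) →
  absSq (z ⊖ w) + absSq (z ⊕ w) ≡ + 2 * absSq z + + 2 * absSq w
absSq-parallelogram {d} z@(a + b ω) w@(c + e ω) = begin
  absSq (z ⊖ w) + absSq (z ⊕ w)
    ≡⟨ cong₂ _+_ (absSq≡norm (z ⊖ w)) (absSq≡norm (z ⊕ w)) ⟩
  norm P Q (a - c) (b - e) + norm P Q (a + c) (b + e) ≡⟨ norm-parallelogram P Q a b c e ⟩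
  + 2 * norm P Q a b + + 2 * norm P Q c e
    ≡⟨ sym (cong₂ (λ m n → + 2 * m + + 2 * n) (absSq≡norm z) (absSq≡norm w)) ⟩
  + 2 * absSq z + + 2 * absSq w ∎
  where
  open ≡-Reasoning
  P = sqP d
  Q = sqQ d

bezout-shift : ∀ {d} (α β u v q : 𝒪 d) →
  (α ⊗ (u ⊖ (q ⊗ β))) ⊕ (β ⊗ (v ⊕ (q ⊗ α))) ≡ (α ⊗ u) ⊕ (β ⊗ v)
bezout-shift {d} (a₁ + a₂ ω) (b₁ + b₂ ω) (u₁ + u₂ ω) (v₁ + v₂ ω) (q₁ + q₂ ω) =
  cong₂ _+_ω (re-part a₁ a₂ b₁ b₂ u₁ u₂ v₁ v₂ q₁ q₂ (sqP d) (sqQ d))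
             (im-part a₁ a₂ b₁ b₂ u₁ u₂ v₁ v₂ q₁ q₂ (sqP d) (sqQ d))
  where
  re-part : ∀ a₁ a₂ b₁ b₂ u₁ u₂ v₁ v₂ q₁ q₂ P Q →
    let x₁ = u₁ - (q₁ * b₁ + q₂ * b₂ * P)
        x₂ = u₂ - (q₁ * b₂ + q₂ * b₁ + q₂ * b₂ * Q)
        y₁ = v₁ + (q₁ * a₁ + q₂ * a₂ * P)
        y₂ = v₂ + (q₁ * a₂ + q₂ * a₁ + q₂ * a₂ * Q)
    in (a₁ * x₁ + a₂ * x₂ * P) + (b₁ * y₁ + b₂ * y₂ * P)
         ≡ (a₁ * u₁ + a₂ * u₂ * P) + (b₁ * v₁ + b₂ * v₂ * P)
  re-part = solve-∀
  im-part : ∀ a₁ a₂ b₁ b₂ u₁ u₂ v₁ v₂ q₁ q₂ P Q →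
    let x₁ = u₁ - (q₁ * b₁ + q₂ * b₂ * P)
        x₂ = u₂ - (q₁ * b₂ + q₂ * b₁ + q₂ * b₂ * Q)
        y₁ = v₁ + (q₁ * a₁ + q₂ * a₂ * P)
        y₂ = v₂ + (q₁ * a₂ + q₂ * a₁ + q₂ * a₂ * Q)
    in (a₁ * x₂ + a₂ * x₁ + a₂ * x₂ * Q) + (b₁ * y₂ + b₂ * y₁ + b₂ * y₂ * Q)
         ≡ (a₁ * u₂ + a₂ * u₁ + a₂ * u₂ * Q) + (b₁ * v₂ + b₂ * v₁ + b₂ * v₂ * Q)
  im-part = solve-∀

⊕-⊖-cancelˡ : ∀ {d} (z w : 𝒪 d) → (z ⊕ w) ⊖ z ≡ w
⊕-⊖-cancelˡ (a + b ω) (c + e ω) = cong₂ _+_ω (cancel a c) (cancel b e)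
  where
  cancel : ∀ a c → (a + c) - a ≡ c
  cancel = solve-∀

⊖-⊗-conj : ∀ {d} (u q β : 𝒪 d) →
  (u ⊖ (q ⊗ β)) ⊗ conj β ≡ (u ⊗ conj β) ⊖ (q ⊗ embed (absSq β))
⊖-⊗-conj {d} (u₁ + u₂ ω) (q₁ + q₂ ω) β@(b₁ + b₂ ω) =
  trans (cong₂ _+_ω (re-part u₁ u₂ q₁ q₂ b₁ b₂ (sqP d) (sqQ d))
                    (im-part u₁ u₂ q₁ q₂ b₁ b₂ (sqP d) (sqQ d)))
        (cong (λ n → ((u₁ + u₂ ω) ⊗ conj β) ⊖ ((q₁ + q₂ ω) ⊗ embed n)) (sym (absSq≡norm β)))
  where
  re-part : ∀ u₁ u₂ q₁ q₂ b₁ b₂ P Q →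
    let x₁ = u₁ - (q₁ * b₁ + q₂ * b₂ * P)
        x₂ = u₂ - (q₁ * b₂ + q₂ * b₁ + q₂ * b₂ * Q)
        N  = b₁ * b₁ + Q * b₁ * b₂ - P * b₂ * b₂
    in x₁ * (b₁ + b₂ * Q) + x₂ * - b₂ * P
         ≡ (u₁ * (b₁ + b₂ * Q) + u₂ * - b₂ * P) - (q₁ * N + q₂ * 0ℤ * P)
  re-part = solve-∀
  im-part : ∀ u₁ u₂ q₁ q₂ b₁ b₂ P Q →
    let x₁ = u₁ - (q₁ * b₁ + q₂ * b₂ * P)
        x₂ = u₂ - (q₁ * b₂ + q₂ * b₁ + q₂ * b₂ * Q)
        N  = b₁ * b₁ + Q * b₁ * b₂ - P * b₂ * b₂
    in x₁ * - b₂ + x₂ * (b₁ + b₂ * Q) + x₂ * - b₂ * Q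
         ≡ (u₁ * - b₂ + u₂ * (b₁ + b₂ * Q) + u₂ * - b₂ * Q) - (q₁ * 0ℤ + q₂ * N + q₂ * 0ℤ * Q)
  im-part = solve-∀

quotient remainder : ∀ {d} (w : 𝒪 d) (M : ℕ) .{{_ : NonZero M}} → 𝒪 d
quotient  w M = (re w /ℕ M) + (im w /ℕ M) ω
remainder w M = (+ (re w %ℕ M)) + (+ (im w %ℕ M)) ω

⊖-quotient : ∀ {d} (w : 𝒪 d) (M : ℕ) .{{_ : NonZero M}} →
  w ⊖ (quotient w M ⊗ embed (+ M)) ≡ remainder w M
⊖-quotient {d} (a + b ω) M = cong₂ _+_ω
  (trans (cong (_- (q₁ * + M + q₂ * 0ℤ * sqP d)) (a≡a%ℕn+[a/ℕn]*n a M))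
         (re-part (+ (a %ℕ M)) q₁ q₂ (+ M) (sqP d)))
  (trans (cong (_- (q₁ * 0ℤ + q₂ * + M + q₂ * 0ℤ * sqQ d)) (a≡a%ℕn+[a/ℕn]*n b M))
         (im-part (+ (b %ℕ M)) q₁ q₂ (+ M) (sqQ d)))
  where
  re-part : ∀ r q₁ q₂ m P → (r + q₁ * m) - (q₁ * m + q₂ * 0ℤ * P) ≡ r
  re-part = solve-∀
  im-part : ∀ s q₁ q₂ m Q → (s + q₂ * m) - (q₁ * 0ℤ + q₂ * m + q₂ * 0ℤ * Q) ≡ s
  im-part = solve-∀
  q₁ = a /ℕ M
  q₂ = b /ℕ M

scaled-bound-cancel : ∀ {y x A N K} .{{_ : NonZero N}} → 1 ≤ A → x ≤ K ℕ.* N →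
  y ℕ.* N ≤ 2 ℕ.+ 2 ℕ.* (A ℕ.* x) → y ≤ (2 ℕ.+ 2 ℕ.* K) ℕ.* A
scaled-bound-cancel {y} {x} {A} {N} {K} 1≤A x≤KN yN≤ =
  ℕ.*-cancelʳ-≤ y ((2 ℕ.+ 2 ℕ.* K) ℕ.* A) N (begin
    y ℕ.* N                                      ≤⟨ yN≤ ⟩
    2 ℕ.+ 2 ℕ.* (A ℕ.* x)                        ≤⟨ ℕ.+-mono-≤ (ℕ.*-monoʳ-≤ 2 1≤AN)
                                                      (ℕ.*-monoʳ-≤ 2 (ℕ.*-monoʳ-≤ A x≤KN)) ⟩
    2 ℕ.* (A ℕ.* N) ℕ.+ 2 ℕ.* (A ℕ.* (K ℕ.* N))  ≡⟨ collect A N K ⟩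
    (2 ℕ.+ 2 ℕ.* K) ℕ.* A ℕ.* N                  ∎)
  where
  open ℕ.≤-Reasoning
  1≤AN : 1 ≤ A ℕ.* N
  1≤AN = ℕ.*-mono-≤ 1≤A (>-nonZero⁻¹ N)
  collect : ∀ A N K → 2 ℕ.* (A ℕ.* N) ℕ.+ 2 ℕ.* (A ℕ.* (K ℕ.* N)) ≡ (2 ℕ.+ 2 ℕ.* K) ℕ.* A ℕ.* N
  collect = ℕ-Solver.solve-∀

‖_‖ : ∀ {d} → 𝒪 d → ℕ
‖ z ‖ = ∣ absSq z ∣

‖⊗‖ : ∀ {d} (z w : 𝒪 d) → ‖ z ⊗ w ‖ ≡ ‖ z ‖ ℕ.* ‖ w ‖
‖⊗‖ z w = trans (cong ∣_∣ (absSq-⊗ z w)) (ℤ.∣i*j∣≡∣i∣*∣j∣ (absSq z) (absSq w))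

‖conj‖ : ∀ {d} (z : 𝒪 d) → ‖ conj z ‖ ≡ ‖ z ‖
‖conj‖ z = cong ∣_∣ (absSq-conj z)

‖one‖ : ∀ {d} → ‖ one𝒪 {d} ‖ ≡ 1
‖one‖ {d} = cong ∣_∣ (absSq-one {d})

module _ {d : ℕ} (0<d : 0 < d) where

  absSq-nonneg : (z : 𝒪 d) → 0ℤ ≤ℤ absSq z
  absSq-nonneg z = subst (0ℤ ≤ℤ_) (sym (absSq≡norm z))
    (norm-nonneg {sqP d} {sqQ d} (discriminant<0 0<d) (re z) (im z))

  absSq≡+‖‖ : (z : 𝒪 d) → absSq z ≡ + ‖ z ‖
  absSq≡+‖‖ z = sym (ℤ.0≤i⇒+∣i∣≡i (absSq-nonneg z))

  ‖‖-nonZero : {z : 𝒪 d} → ¬ (z ≡ zero𝒪) → NonZero ‖ z ‖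
  ‖‖-nonZero {a + b ω} z≢0 = ≢-nonZero λ ‖z‖≡0 → z≢0 (zero-coordinates
    (norm≡0⇒≡0 {sqP d} {sqQ d} (discriminant<0 0<d) a b
      (trans (sym (absSq≡norm {d} (a + b ω))) (ℤ.∣i∣≡0⇒i≡0 ‖z‖≡0))))
    where
    zero-coordinates : a ≡ 0ℤ × b ≡ 0ℤ → a + b ω ≡ zero𝒪
    zero-coordinates (refl , refl) = refl

  ‖⊖‖≤ : (z w : 𝒪 d) → ‖ z ⊖ w ‖ ≤ 2 ℕ.* ‖ z ‖ ℕ.+ 2 ℕ.* ‖ w ‖
  ‖⊖‖≤ z w = ℕ.≤-trans (ℕ.m≤m+n ‖ z ⊖ w ‖ ‖ z ⊕ w ‖) (ℕ.≤-reflexive (ℤ.+-injective (begin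
    + (‖ z ⊖ w ‖ ℕ.+ ‖ z ⊕ w ‖)
      ≡⟨ sym (cong₂ _+_ (absSq≡+‖‖ (z ⊖ w)) (absSq≡+‖‖ (z ⊕ w))) ⟩
    absSq (z ⊖ w) + absSq (z ⊕ w)         ≡⟨ absSq-parallelogram z w ⟩
    + 2 * absSq z + + 2 * absSq w
      ≡⟨ cong₂ (λ m n → + 2 * m + + 2 * n) (absSq≡+‖‖ z) (absSq≡+‖‖ w) ⟩
    + 2 * + ‖ z ‖ + + 2 * + ‖ w ‖
      ≡⟨ sym (cong₂ _+_ (ℤ.pos-* 2 ‖ z ‖) (ℤ.pos-* 2 ‖ w ‖)) ⟩
    + (2 ℕ.* ‖ z ‖ ℕ.+ 2 ℕ.* ‖ w ‖)       ∎)))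
    where open ≡-Reasoning

  ‖remainder‖≤ : (w : 𝒪 d) (M : ℕ) .{{_ : NonZero M}} →
    ‖ remainder w M ‖ ≤ (2 ℕ.+ d) ℕ.* (M ℕ.* M)
  ‖remainder‖≤ w M with sqP≡-k d
  ... | k , k≤1+d , P≡-k = ℤ.drop‿+≤+ (begin
    + ‖ remainder w M ‖              ≡⟨ sym (absSq≡+‖‖ (remainder w M)) ⟩
    absSq (remainder w M)            ≡⟨ absSq≡norm (remainder w M) ⟩
    norm (sqP d) (sqQ d) (+ r) (+ s) ≡⟨ cong (λ P → norm P (sqQ d) (+ r) (+ s)) P≡-k ⟩
    norm (- + k) (sqQ d) (+ r) (+ s) ≤⟨ norm-≤ {k} (sqQ≤0 d) (ℕ.<⇒≤ (n%ℕd<d (re w) M))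
                                                           (ℕ.<⇒≤ (n%ℕd<d (im w) M)) ⟩
    + ((1 ℕ.+ k) ℕ.* (M ℕ.* M))      ≤⟨ +≤+ (ℕ.*-monoˡ-≤ (M ℕ.* M) (s≤s k≤1+d)) ⟩
    + ((2 ℕ.+ d) ℕ.* (M ℕ.* M))      ∎)
    where
    open ℤ.≤-Reasoning
    r = re w %ℕ M
    s = im w %ℕ M

  division-with-small-remainder : (u β : 𝒪 d) → ¬ (β ≡ zero𝒪) →
    ∃[ q ] ‖ u ⊖ (q ⊗ β) ‖ ≤ (2 ℕ.+ d) ℕ.* ‖ β ‖
  division-with-small-remainder u β β≢0 = q , ℕ.*-cancelʳ-≤ ‖ x ‖ ((2 ℕ.+ d) ℕ.* M) M (begin
    ‖ x ‖ ℕ.* M                    ≡⟨ cong (‖ x ‖ ℕ.*_) (sym (‖conj‖ β)) ⟩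
    ‖ x ‖ ℕ.* ‖ conj β ‖           ≡⟨ sym (‖⊗‖ x (conj β)) ⟩
    ‖ x ⊗ conj β ‖                 ≡⟨ cong ‖_‖ (⊖-⊗-conj u q β) ⟩
    ‖ w ⊖ (q ⊗ embed (absSq β)) ‖  ≡⟨ cong (λ n → ‖ w ⊖ (q ⊗ embed n) ‖) (absSq≡+‖‖ β) ⟩
    ‖ w ⊖ (q ⊗ embed (+ M)) ‖      ≡⟨ cong ‖_‖ (⊖-quotient w M) ⟩
    ‖ remainder w M ‖              ≤⟨ ‖remainder‖≤ w M ⟩
    (2 ℕ.+ d) ℕ.* (M ℕ.* M)        ≡⟨ sym (ℕ.*-assoc (2 ℕ.+ d) M M) ⟩
    (2 ℕ.+ d) ℕ.* M ℕ.* M          ∎)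
    where
    open ℕ.≤-Reasoning
    M = ‖ β ‖
    instance
      M-nonZero : NonZero M
      M-nonZero = ‖‖-nonZero β≢0
    w = u ⊗ conj β
    q = quotient w M
    x = u ⊖ (q ⊗ β)

  cofactor-bound : (α β x y : 𝒪 d) → (α ⊗ x) ⊕ (β ⊗ y) ≡ one𝒪 →
    ‖ y ‖ ℕ.* ‖ β ‖ ≤ 2 ℕ.+ 2 ℕ.* (‖ α ‖ ℕ.* ‖ x ‖)
  cofactor-bound α β x y αx+βy≡1 = begin
    ‖ y ‖ ℕ.* ‖ β ‖                       ≡⟨ ℕ.*-comm ‖ y ‖ ‖ β ‖ ⟩
    ‖ β ‖ ℕ.* ‖ y ‖                       ≡⟨ sym (‖⊗‖ β y) ⟩
    ‖ β ⊗ y ‖                             ≡⟨ cong ‖_‖ (sym (⊕-⊖-cancelˡ (α ⊗ x) (β ⊗ y))) ⟩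
    ‖ ((α ⊗ x) ⊕ (β ⊗ y)) ⊖ (α ⊗ x) ‖     ≡⟨ cong (λ z → ‖ z ⊖ (α ⊗ x) ‖) αx+βy≡1 ⟩
    ‖ one𝒪 ⊖ (α ⊗ x) ‖                    ≤⟨ ‖⊖‖≤ one𝒪 (α ⊗ x) ⟩
    2 ℕ.* ‖ one𝒪 {d} ‖ ℕ.+ 2 ℕ.* ‖ α ⊗ x ‖
      ≡⟨ cong₂ (λ m n → 2 ℕ.* m ℕ.+ 2 ℕ.* n) (‖one‖ {d}) (‖⊗‖ α x) ⟩
    2 ℕ.+ 2 ℕ.* (‖ α ‖ ℕ.* ‖ x ‖)          ∎
    where open ℕ.≤-Reasoning

  ‖‖≤⇒absSq≤ : ∀ {c} (z w : 𝒪 d) → ‖ z ‖ ≤ c ℕ.* c ℕ.* ‖ w ‖ → absSq z ≤ℤ + c * + c * absSq w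
  ‖‖≤⇒absSq≤ {c} z w ‖z‖≤ = subst₂ _≤ℤ_ (sym (absSq≡+‖‖ z)) lift (+≤+ ‖z‖≤)
    where
    lift : + (c ℕ.* c ℕ.* ‖ w ‖) ≡ + c * + c * absSq w
    lift = trans (ℤ.pos-* (c ℕ.* c) ‖ w ‖)
                 (cong₂ _*_ (ℤ.pos-* c c) (sym (absSq≡+‖‖ w)))

  bezout-with-small-cofactors : (α β : 𝒪 d) → ¬ (α ≡ zero𝒪) → ¬ (β ≡ zero𝒪) →
    GeneratesUnitIdeal α β →
    ∃[ x ] ∃[ y ] ((α ⊗ x) ⊕ (β ⊗ y) ≡ one𝒪)
      × ‖ x ‖ ≤ (2 ℕ.+ d) ℕ.* ‖ β ‖ × ‖ y ‖ ≤ (2 ℕ.+ 2 ℕ.* (2 ℕ.+ d)) ℕ.* ‖ α ‖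
  bezout-with-small-cofactors α β α≢0 β≢0 (u , v , αu+βv≡1) =
    x , y , αx+βy≡1 , ‖x‖≤
      , scaled-bound-cancel {‖ y ‖} {‖ x ‖} {‖ α ‖} {‖ β ‖} {2 ℕ.+ d} {{‖‖-nonZero β≢0}}
          1≤‖α‖ ‖x‖≤ (cofactor-bound α β x y αx+βy≡1)
    where
    q : 𝒪 d
    q = proj₁ (division-with-small-remainder u β β≢0)
    x y : 𝒪 d
    x = u ⊖ (q ⊗ β)
    y = v ⊕ (q ⊗ α)
    αx+βy≡1 : (α ⊗ x) ⊕ (β ⊗ y) ≡ one𝒪
    αx+βy≡1 = trans (bezout-shift α β u v q) αu+βv≡1
    ‖x‖≤ : ‖ x ‖ ≤ (2 ℕ.+ d) ℕ.* ‖ β ‖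
    ‖x‖≤ = proj₂ (division-with-small-remainder u β β≢0)
    1≤‖α‖ : 1 ≤ ‖ α ‖
    1≤‖α‖ = >-nonZero⁻¹ ‖ α ‖ {{‖‖-nonZero α≢0}}

lemma3p2 : (d : ℕ) → 0 < d → Squarefree d →
    ∃[ C ] (1 ≤ C ×
      ((α β : 𝒪 d) → ¬ (α ≡ zero𝒪) → ¬ (β ≡ zero𝒪) → GeneratesUnitIdeal α β →
        ∃[ x ] ∃[ y ] ((((α ⊗ x) ⊕ (β ⊗ y)) ≡ one𝒪)
          × (absSq x ≤ℤ (+ C) * (+ C) * absSq β)
          × (absSq y ≤ℤ (+ C) * (+ C) * absSq α))))
lemma3p2 d 0<d _ = C , s≤s z≤n , λ α β α≢0 β≢0 ⟨α,β⟩≡𝒪 →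
  let (x , y , αx+βy≡1 , ‖x‖≤ , ‖y‖≤) = bezout-with-small-cofactors 0<d α β α≢0 β≢0 ⟨α,β⟩≡𝒪
  in x , y , αx+βy≡1 , ‖‖≤⇒absSq≤ 0<d {C} x β (ℕ.≤-trans ‖x‖≤ (ℕ.*-monoˡ-≤ ‖ β ‖ K≤C²))
                     , ‖‖≤⇒absSq≤ 0<d {C} y α (ℕ.≤-trans ‖y‖≤ (ℕ.*-monoˡ-≤ ‖ α ‖ C≤C²))
  where
  K = 2 ℕ.+ d
  C = 2 ℕ.+ 2 ℕ.* K
  C≤C² : C ≤ C ℕ.* C
  C≤C² = ℕ.m≤m*n C C
  K≤C² : K ≤ C ℕ.* C
  K≤C² = ℕ.≤-trans (ℕ.≤-trans (ℕ.m≤n*m K 2) (ℕ.m≤n+m (2 ℕ.* K) 2)) C≤C²
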